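{- Let $G$ be a simple graph of order $n\ge2$ and $t\ge 2$. If $C$ is a clique in $S[G,t]$ with $|C|\ge 4$, then there exists $i\in\{1,\dots,n\}$ such that $C\subseteq V\big(S_i[G,t]\big)$.
   Context: Let $G$ be a simple graph with vertex set $V=\{1,\dots,n\}$, $n\ge 2$. For $t\ge 1$, the generalized Sierpiński graph $S(G,t)$ has vertex set $V^t$ (words $u_1u_2\cdots u_t$ over $V$), and two words ${\bf u}=u_1\cdots u_t$, ${\bf v}=v_1\cdots v_t$ are adjacent iff there is $i\in\{1,\dots,t\}$ with $u_j=v_j$ for $j<i$, $u_i\neq v_i$ and $u_iv_i\in E(G)$, and $u_j=v_i$, $v_j=u_i$ for all $j>i$. An edge of this kind with $i<t$ is called a linking edge. The generalized Sierpiński gasket $S[G,t]$ is the graph obtained from $S(G,t)$ by contracting all linking edges; each vertex of $S[G,t]$ thus corresponds to one word of $V^t$ or to the two endpoints (its expanded forms) of a contracted linking edge. For $t\ge 2$ and $i\in V$, $S_i[G,t]$ is the subgraph of $S[G,t]$ induced by the vertices having a word (or an expanded form) beginning with the letter $i$; it is isomorphic to $S[G,t-1]$. -}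

module Defs where

open import Data.Nat using (ℕ; zero; suc; _<_; _≤_)
open import Data.Fin using (Fin; toℕ; fromℕ<)
open import Data.Vec using (Vec; lookup)
open import Data.Product using (Σ; ∃; _×_; _,_)
open import Data.Sum using (_⊎_)
open import Relation.Binary.PropositionalEquality using (_≡_; _≢_)
open import Relation.Binary.Construct.Closure.ReflexiveTransitive using (Star)
open import Relation.Nullary using (¬_)
open import Level using (Level; _⊔_) renaming (suc to lsuc; zero to lzero)

record SimpleGraph (n : ℕ) : Set₁ where
  field
    Adj    : Fin n → Fin n → Set
    sym    : ∀ {a b} → Adj a b → Adj b a
    irrefl : ∀ a → ¬ Adj a a

-- Words of length t over V = Fin n : vertices of S(G,t).
Word : ℕ → ℕ → Set
Word n t = Vec (Fin n) t

module _ {n : ℕ} (G : SimpleGraph n) {t : ℕ} where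
  open SimpleGraph G

  SAdjAt : Fin t → Word n t → Word n t → Set
  SAdjAt i u v =
    (∀ (j : Fin t) → toℕ j < toℕ i → lookup u j ≡ lookup v j) ×
    (lookup u i ≢ lookup v i) ×
    Adj (lookup u i) (lookup v i) ×
    (∀ (j : Fin t) → toℕ i < toℕ j →
       (lookup u j ≡ lookup v i) × (lookup v j ≡ lookup u i))

  SAdj : Word n t → Word n t → Set
  SAdj u v = ∃ λ (i : Fin t) → SAdjAt i u v

  -- Linking edges: edges of S(G,t) whose index i satisfies i < t
  -- (with 1-based indices; i.e. toℕ i + 1 < t for 0-based Fin t).
  Linking : Word n t → Word n t → Set
  Linking u v = ∃ λ (i : Fin t) → (suc (toℕ i) < t) × SAdjAt i u v

  -- Two words represent the same vertex of S[G,t] (contracting all linking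
  -- edges): they are connected by a path of linking edges.
  Same : Word n t → Word n t → Set
  Same = Star Linking

  GAdj : Word n t → Word n t → Set
  GAdj u v = ¬ Same u v × ∃ λ u' → ∃ λ v' → Same u u' × Same v v' × SAdj u' v'

  IsClique : {k : ℕ} → Vec (Word n t) k → Set
  IsClique {k} C = ∀ (p q : Fin k) → p ≢ q → GAdj (lookup C p) (lookup C q)

  BeginsWith : Fin n → Word n t → Set
  BeginsWith i w = Σ (0 < t) λ h → lookup w (fromℕ< h) ≡ i

  InSi : Fin n → Word n t → Set
  InSi i u = ∃ λ w → Same u w × BeginsWith i w

{-# OPTIONS --safe #-}
-- Every word has at most one linking neighbour, so a vertex of S[G,t] has at most two
-- expanded forms and lies in at most two of the S_i; a vertex lying in both S_a and S_b
-- (a ≠ b) is the contracted edge {ab…b, ba…a}, hence two distinct vertices share at most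
-- one letter. Adjacent vertices share at least one, since an edge at the first position is
-- a linking edge. In a clique v₀, v₁, v₂, v₃, … two of the letters v₀ shares with v₁, v₂, v₃
-- coincide, giving a letter a of three vertices; any other vertex p shares letters with
-- these three, two of which coincide and therefore equal a.
module Submission where

open import Defs
open import Data.Nat using (ℕ; suc; _≤_; _<_; z≤n; s≤s; s≤s⁻¹)
open import Data.Nat.Properties using (<-cmp)
open import Data.Fin using (Fin; toℕ; fromℕ; #_) renaming (zero to fzero; suc to fsuc)
open import Data.Fin.Properties using (toℕ-injective; toℕ-fromℕ; _≟_)
open import Data.Vec using (Vec; lookup; replicate; _∷_)
open import Data.Vec.Properties using (lookup-replicate)
open import Data.Vec.Relation.Binary.Pointwise.Extensional using (ext; Pointwise-≡⇒≡)
open import Data.Product using (∃; _×_; _,_; proj₁; proj₂; swap)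
open import Data.Sum using (_⊎_; inj₁; inj₂)
open import Data.Empty using (⊥-elim)
open import Relation.Nullary using (¬_; yes; no)
open import Relation.Binary using (tri<; tri≈; tri>)
open import Relation.Binary.PropositionalEquality
open import Function using (_∘_)
open import Relation.Binary.Construct.Closure.ReflexiveTransitive using (ε; _◅_; _◅◅_; reverse)

private
  variable
    n t : ℕ
    a b c : Fin n

first : Word n (suc t) → Fin n
first w = lookup w fzero

-- The expanded form a b…b in S_a of the contracted linking edge between S_a and S_b.
bridge : Fin n → Fin n → Word n (suc t)
bridge a b = a ∷ replicate _ b

below-last : {i : Fin (suc t)} → suc (toℕ i) < suc t → toℕ i < toℕ (fromℕ t)
below-last {t} i<t rewrite toℕ-fromℕ t = s≤s⁻¹ i<t

module _ (G : SimpleGraph n) where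
  open SimpleGraph G using () renaming (sym to Adj-sym)

  SAdjAt-sym : {i : Fin t} {u v : Word n t} → SAdjAt G i u v → SAdjAt G i v u
  SAdjAt-sym (before , differ , adj , after) =
    (λ j j<i → sym (before j j<i)) , (λ e → differ (sym e)) , Adj-sym adj , (λ j i<j → swap (after j i<j))

  Linking-sym : {u v : Word n t} → Linking G u v → Linking G v u
  Linking-sym {u = u} {v} (i , i<t , adj) = i , i<t , SAdjAt-sym {u = u} {v} adj

  Same-sym : {u v : Word n t} → Same G u v → Same G v u
  Same-sym = reverse λ {u} {v} → Linking-sym {u = u} {v}

  letter-at-linking-position : {i : Fin (suc t)} {y x : Word n (suc t)} → toℕ i < toℕ (fromℕ t) →
    SAdjAt G i y x → lookup x i ≡ lookup y (fromℕ t)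
  letter-at-linking-position i<last (_ , _ , _ , after) = sym (proj₁ (after _ i<last))

  -- A linking edge at position i makes y constant after i and different from that constant
  -- at i: i is where the constant tail of y begins.
  linking-positions-not-< : {i j : Fin (suc t)} {y x w : Word n (suc t)} →
    toℕ i < toℕ (fromℕ t) → toℕ j < toℕ (fromℕ t) →
    SAdjAt G i y x → SAdjAt G j y w → ¬ toℕ i < toℕ j
  linking-positions-not-< {i = i} {j} {y} {x} {w} i<last j<last
    adjˣ@(_ , _ , _ , afterˣ) adjʷ@(_ , differ , _) i<j =
    differ (begin
      lookup y j           ≡⟨ proj₁ (afterˣ j i<j) ⟩
      lookup x i           ≡⟨ letter-at-linking-position {y = y} {x} i<last adjˣ ⟩
      lookup y (fromℕ _)   ≡⟨ letter-at-linking-position {y = y} {w} j<last adjʷ ⟨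
      lookup w j           ∎)
    where open ≡-Reasoning

  linking-position-unique : {i j : Fin (suc t)} {y x w : Word n (suc t)} →
    toℕ i < toℕ (fromℕ t) → toℕ j < toℕ (fromℕ t) →
    SAdjAt G i y x → SAdjAt G j y w → i ≡ j
  linking-position-unique {i = i} {j} {y} {x} {w} i<last j<last adjˣ adjʷ with <-cmp (toℕ i) (toℕ j)
  ... | tri< i<j _ _ = ⊥-elim (linking-positions-not-< {y = y} {x} {w} i<last j<last adjˣ adjʷ i<j)
  ... | tri≈ _ i≡j _ = toℕ-injective i≡j
  ... | tri> _ _ j<i = ⊥-elim (linking-positions-not-< {y = y} {w} {x} j<last i<last adjʷ adjˣ j<i)

  SAdjAt-functional : {i : Fin (suc t)} {y x w : Word n (suc t)} → toℕ i < toℕ (fromℕ t) →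
    SAdjAt G i y x → SAdjAt G i y w → x ≡ w
  SAdjAt-functional {i = i} {y} {x} {w} i<last
    adjˣ@(beforeˣ , _ , _ , afterˣ) adjʷ@(beforeʷ , _ , _ , afterʷ) =
    Pointwise-≡⇒≡ (ext same-letter)
    where
    same-letter : ∀ j → lookup x j ≡ lookup w j
    same-letter j with <-cmp (toℕ j) (toℕ i)
    ... | tri< j<i _ _ = trans (sym (beforeˣ j j<i)) (beforeʷ j j<i)
    ... | tri> _ _ i<j = trans (proj₂ (afterˣ j i<j)) (sym (proj₂ (afterʷ j i<j)))
    ... | tri≈ _ j≡i _ rewrite toℕ-injective j≡i =
      trans (letter-at-linking-position {y = y} {x} i<last adjˣ)
            (sym (letter-at-linking-position {y = y} {w} i<last adjʷ))

  Linking-functional : {y x w : Word n (suc t)} → Linking G y x → Linking G y w → x ≡ w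
  Linking-functional {y = y} {x} {w} (i , i<t , adjˣ) (j , j<t , adjʷ)
    with refl ← linking-position-unique {y = y} {x} {w} (below-last i<t) (below-last j<t) adjˣ adjʷ =
    SAdjAt-functional {y = y} {x} {w} (below-last i<t) adjˣ adjʷ

  Same⇒≡⊎Linking : {x w : Word n (suc t)} → Same G x w → x ≡ w ⊎ Linking G x w
  Same⇒≡⊎Linking ε = inj₁ refl
  Same⇒≡⊎Linking {x = x} {w} (_◅_ {j = y} link path) with Same⇒≡⊎Linking path
  ... | inj₁ refl  = inj₂ link
  ... | inj₂ link′ = inj₁ (Linking-functional {y = y} {x} {w} (Linking-sym {u = x} {y} link) link′)

  Linking-across⇒bridge : {x w : Word n (suc t)} → Linking G x w → first x ≢ first w →
    w ≡ bridge (first w) (first x)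
  Linking-across⇒bridge {x = x} {w} (fzero , _ , _ , _ , _ , after) _ = Pointwise-≡⇒≡ (ext letters)
    where
    letters : ∀ j → lookup w j ≡ lookup (bridge (first w) (first x)) j
    letters fzero    = refl
    letters (fsuc j) = trans (proj₂ (after (fsuc j) (s≤s z≤n))) (sym (lookup-replicate j _))
  Linking-across⇒bridge (fsuc _ , _ , before , _) differ = ⊥-elim (differ (before fzero (s≤s z≤n)))

  record LinkedInto (x : Word n (suc t)) (a : Fin n) : Set where
    constructor linked
    field
      partner        : Word n (suc t)
      linking        : Linking G x partner
      partner-begins : first partner ≡ a

  InSi⇒first⊎LinkedInto : {x : Word n (suc t)} → InSi G a x → first x ≡ a ⊎ LinkedInto x a
  InSi⇒first⊎LinkedInto (w , x~w , _ , w₀≡a) with Same⇒≡⊎Linking x~w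
  ... | inj₁ refl = inj₁ w₀≡a
  ... | inj₂ link = inj₂ (linked w link w₀≡a)

  LinkedInto-functional : {x : Word n (suc t)} → LinkedInto x a → LinkedInto x b → a ≡ b
  LinkedInto-functional {x = x} (linked w₁ link₁ refl) (linked w₂ link₂ refl) =
    cong first (Linking-functional {y = x} {w₁} {w₂} link₁ link₂)

  at-most-two-letters : {x : Word n (suc t)} → InSi G a x → InSi G b x → InSi G c x →
    a ≡ b ⊎ a ≡ c ⊎ b ≡ c
  at-most-two-letters xa xb xc
    with InSi⇒first⊎LinkedInto xa | InSi⇒first⊎LinkedInto xb | InSi⇒first⊎LinkedInto xc
  ... | inj₁ refl | inj₁ refl | _         = inj₁ refl
  ... | inj₁ refl | inj₂ _    | inj₁ refl = inj₂ (inj₁ refl)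
  ... | inj₁ _    | inj₂ lb   | inj₂ lc   = inj₂ (inj₂ (LinkedInto-functional lb lc))
  ... | inj₂ _    | inj₁ refl | inj₁ refl = inj₂ (inj₂ refl)
  ... | inj₂ la   | inj₁ _    | inj₂ lc   = inj₂ (inj₁ (LinkedInto-functional la lc))
  ... | inj₂ la   | inj₂ lb   | _         = inj₁ (LinkedInto-functional la lb)

  two-letters⇒Same-bridge : {x : Word n (suc t)} → InSi G a x → InSi G b x → a ≢ b →
    Same G x (bridge a b)
  two-letters⇒Same-bridge {x = x} xa xb a≢b with InSi⇒first⊎LinkedInto xa | InSi⇒first⊎LinkedInto xb
  ... | inj₁ refl | inj₁ refl = ⊥-elim (a≢b refl)
  ... | inj₁ refl | inj₂ (linked w link refl) =
    subst (Same G x) (Linking-across⇒bridge {x = w} {x} (Linking-sym {u = x} {w} link) (a≢b ∘ sym)) ε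
  ... | inj₂ (linked w link refl) | inj₁ refl =
    subst (Same G x) (Linking-across⇒bridge {x = x} {w} link (a≢b ∘ sym)) (link ◅ ε)
  ... | inj₂ la | inj₂ lb = ⊥-elim (a≢b (LinkedInto-functional la lb))

  two-shared-letters⇒Same : {x y : Word n (suc t)} →
    InSi G a x → InSi G b x → InSi G a y → InSi G b y → a ≢ b → Same G x y
  two-shared-letters⇒Same xa xb ya yb a≢b =
    two-letters⇒Same-bridge xa xb a≢b ◅◅ Same-sym (two-letters⇒Same-bridge ya yb a≢b)

  GAdj⇒shared-letter : {x y : Word n (suc (suc t))} → GAdj G x y → ∃ λ a → InSi G a x × InSi G a y
  -- As t ≥ 2, an edge at the first position is a linking edge.
  GAdj⇒shared-letter (x≁y , x′ , y′ , x~x′ , y~y′ , fzero , adj) =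
    ⊥-elim (x≁y (x~x′ ◅◅ (fzero , s≤s (s≤s z≤n) , adj) ◅ Same-sym y~y′))
  GAdj⇒shared-letter (_ , x′ , y′ , x~x′ , y~y′ , fsuc _ , before , _) =
    first x′ , (x′ , x~x′ , s≤s z≤n , refl) , (y′ , y~y′ , s≤s z≤n , sym (before fzero (s≤s z≤n)))

  GAdj-shared-letter-unique : {x y : Word n (suc (suc t))} → GAdj G x y →
    InSi G a x → InSi G a y → InSi G b x → InSi G b y → a ≡ b
  GAdj-shared-letter-unique {a = a} {b} (x≁y , _) xa ya xb yb with a ≟ b
  ... | yes a≡b = a≡b
  ... | no a≢b  = ⊥-elim (x≁y (two-shared-letters⇒Same xa xb ya yb a≢b))

  module _ {t k : ℕ} (C : Vec (Word n (suc (suc t))) k) (clique : IsClique G C) where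

    _∈S_ : Fin k → Fin n → Set
    p ∈S a = InSi G a (lookup C p)

    joins-letter : {i j p : Fin k} → i ≢ j → i ∈S a → j ∈S a → i ∈S b → j ∈S b → p ∈S b → p ∈S a
    joins-letter {p = p} i≢j ia ja ib jb =
      subst (p ∈S_) (sym (GAdj-shared-letter-unique (clique _ _ i≢j) ia ja ib jb))

    letter-of-three-spreads : (i j l : Fin k) → i ≢ j → i ≢ l → j ≢ l →
      i ∈S a → j ∈S a → l ∈S a → ∀ p → p ∈S a
    letter-of-three-spreads i j l i≢j i≢l j≢l ia ja la p with p ≟ i | p ≟ j | p ≟ l
    ... | yes refl | _        | _        = ia
    ... | no _     | yes refl | _        = ja
    ... | no _     | no _     | yes refl = la
    ... | no p≢i   | no p≢j   | no p≢l
      with GAdj⇒shared-letter (clique p i p≢i) | GAdj⇒shared-letter (clique p j p≢j)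
         | GAdj⇒shared-letter (clique p l p≢l)
    ... | b₀ , pb₀ , ib₀ | b₁ , pb₁ , jb₁ | b₂ , pb₂ , lb₂ with at-most-two-letters pb₀ pb₁ pb₂
    ... | inj₁ refl        = joins-letter i≢j ia ja ib₀ jb₁ pb₀
    ... | inj₂ (inj₁ refl) = joins-letter i≢l ia la ib₀ lb₂ pb₀
    ... | inj₂ (inj₂ refl) = joins-letter j≢l ja la jb₁ lb₂ pb₁

mainTheorem13 : (n : ℕ) → 2 ≤ n → (G : SimpleGraph n) → (t : ℕ) → 2 ≤ t →
    (k : ℕ) → 4 ≤ k → (C : Vec (Word n t) k) → IsClique G C →
    ∃ λ (i : Fin n) → ∀ (p : Fin k) → InSi G i (lookup C p)
mainTheorem13 _ _ G (suc (suc t)) (s≤s (s≤s z≤n)) (suc (suc (suc (suc k)))) (s≤s (s≤s (s≤s (s≤s _)))) C clique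
  with GAdj⇒shared-letter G (clique (# 0) (# 1) (λ ())) | GAdj⇒shared-letter G (clique (# 0) (# 2) (λ ()))
     | GAdj⇒shared-letter G (clique (# 0) (# 3) (λ ()))
... | a₁ , 0a₁ , 1a₁ | a₂ , 0a₂ , 2a₂ | a₃ , 0a₃ , 3a₃ with at-most-two-letters G 0a₁ 0a₂ 0a₃
... | inj₁ refl        = a₁ , letter-of-three-spreads G C clique (# 0) (# 1) (# 2) (λ ()) (λ ()) (λ ()) 0a₁ 1a₁ 2a₂
... | inj₂ (inj₁ refl) = a₁ , letter-of-three-spreads G C clique (# 0) (# 1) (# 3) (λ ()) (λ ()) (λ ()) 0a₁ 1a₁ 3a₃
... | inj₂ (inj₂ refl) = a₂ , letter-of-three-spreads G C clique (# 0) (# 2) (# 3) (λ ()) (λ ()) (λ ()) 0a₂ 2a₂ 3a₃
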